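{- Let $S\subseteq\{1,\ldots,n\}^2$ contain no three points $a,b,c$ forming a lazy-$L$-configuration. Then $|S|\le 3n$.
   Context: A point $(x_i,y_i)$ SE-dominates a point $(x_j,y_j)$ if $x_i>x_j$ and $y_i<y_j$. Three points $a=(x_0,y_0)$, $b=(x_0,y_1)$ and $c=(x_1,y_2)$ form a lazy-$L$-configuration if $y_1>y_0$ and $c$ SE-dominates $b$ (i.e. $x_1>x_0$ and $y_2<y_1$). -}

module Defs where

open import Data.Nat using (ℕ; _≤_; _<_)
open import Data.Product using (_×_; _,_; proj₁; proj₂)
open import Relation.Binary.PropositionalEquality using (_≡_)

Point : Set
Point = ℕ × ℕ

InGrid : ℕ → Point → Set
InGrid n (x , y) = (1 ≤ x × x ≤ n) × (1 ≤ y × y ≤ n)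

SEDominates : Point → Point → Set
SEDominates (xi , yi) (xj , yj) = (xj < xi) × (yi < yj)

LazyL : Point → Point → Point → Set
LazyL a b c = (proj₁ a ≡ proj₁ b) × (proj₂ a < proj₂ b) × SEDominates c b

module Submission where

-- Call a point of S *raised* if some point of S lies strictly below
-- it in the same column, and *lowest* otherwise.
--   • Two distinct lowest points never share a column: the lower one would
--     lie below the other.  Hence their x-coordinates are pairwise distinct.
--   • Two distinct raised points never share a row: if p is left of q in the
--     same row, a point a below p, p itself and a point c below q form a
--     lazy-L.  Hence their y-coordinates are pairwise distinct.
-- Each class is therefore injectively keyed by a coordinate in {1,…,n}, so
-- each has at most n elements.

open import Defs
open import Data.Nat using (ℕ; zero; suc; _≤_; _<_; _+_; _*_; z≤n; s≤s; _≟_; _<?_)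
open import Data.Nat.Properties
  using (<⇒≱; ≤∧≢⇒<; ≤-pred; ≤-trans; ≤-reflexive; ≤-antisym; ≮⇒≥; +-suc;
         +-mono-≤; +-monoʳ-≤; m≤m+n; module ≤-Reasoning)
open import Data.List using (List; []; _∷_; length; filter; map)
open import Data.List.Properties using (filter-all; length-map)
open import Data.List.Relation.Unary.All as All using (All; []; _∷_)
import Data.List.Relation.Unary.All.Properties as All
open import Data.List.Relation.Unary.Any using (Any; any?; here; there)
open import Data.List.Relation.Unary.AllPairs using ([]; _∷_)
open import Data.List.Relation.Unary.Unique.Propositional using (Unique)
open import Data.List.Relation.Unary.Unique.Propositional.Properties
  using (filter⁺)
open import Data.List.Membership.Propositional using (_∈_; find; lose)
open import Data.List.Membership.Propositional.Properties using (∈-filter⁻)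
open import Data.Product using (_×_; _,_; proj₁; proj₂)
open import Data.Product.Properties using (×-≡,≡→≡)
open import Function using (_∘_)
open import Relation.Nullary using (¬_; Dec; yes; no; ¬?; contradiction)
open import Relation.Nullary.Decidable using (_×-dec_)
open import Relation.Binary.Definitions using (DecidableEquality)
open import Relation.Binary.PropositionalEquality
  using (_≡_; _≢_; refl; sym; trans; cong; ≢-sym)

length-filter-split : ∀ {A : Set} {P : A → Set} (P? : ∀ x → Dec (P x)) (xs : List A) →
  length xs ≡ length (filter P? xs) + length (filter (¬? ∘ P?) xs)
length-filter-split P? [] = refl
length-filter-split P? (x ∷ xs) with P? x
... | yes _ = cong suc (length-filter-split P? xs)
... | no  _ = trans (cong suc (length-filter-split P? xs)) (sym (+-suc _ _))

length-≤-delete : ∀ {A : Set} (_≟ᴬ_ : DecidableEquality A) (v : A) (xs : List A) →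
  Unique xs → length xs ≤ suc (length (filter (λ x → ¬? (x ≟ᴬ v)) xs))
length-≤-delete _≟ᴬ_ v [] _ = z≤n
length-≤-delete _≟ᴬ_ v (x ∷ xs) (x∉xs ∷ u) with x ≟ᴬ v
... | yes refl = s≤s (≤-reflexive (sym (cong length (filter-all (λ y → ¬? (y ≟ᴬ v)) others))))
  where
  others : All (_≢ v) xs
  others = All.map ≢-sym x∉xs
... | no _ = s≤s (length-≤-delete _≟ᴬ_ v xs u)

-- A duplicate-free list of numbers from {1,…,n} has at most n elements.
-- Induction on n: deleting n leaves a list in {1,…,n-1}.
unique-in-range-length : ∀ n (xs : List ℕ) → Unique xs →
  All (λ x → 1 ≤ x × x ≤ n) xs → length xs ≤ n
unique-in-range-length zero [] _ _ = z≤n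
unique-in-range-length zero (x ∷ _) _ ((1≤x , x≤0) ∷ _) = contradiction x≤0 (<⇒≱ 1≤x)
unique-in-range-length (suc m) xs u range =
  ≤-trans (length-≤-delete _≟_ (suc m) xs u)
          (s≤s (unique-in-range-length m rest (filter⁺ keep? u) rest-range))
  where
  keep? : ∀ x → Dec (x ≢ suc m)
  keep? x = ¬? (x ≟ suc m)
  rest : List ℕ
  rest = filter keep? xs
  rest-range : All (λ x → 1 ≤ x × x ≤ m) rest
  rest-range = All.zipWith (λ ((1≤x , x≤1+m) , x≢1+m) → 1≤x , ≤-pred (≤∧≢⇒< x≤1+m x≢1+m))
                           (All.filter⁺ keep? range , All.all-filter keep? xs)

InjectiveOn : ∀ {A B : Set} → (A → B) → List A → Set
InjectiveOn k xs = ∀ {p q} → p ∈ xs → q ∈ xs → k p ≡ k q → p ≡ q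

map-unique : ∀ {A B : Set} (k : A → B) (xs : List A) →
  Unique xs → InjectiveOn k xs → Unique (map k xs)
map-unique k [] _ _ = []
map-unique k (x ∷ xs) (x∉xs ∷ u) inj =
  All.map⁺ (All.tabulate λ y∈xs kx≡ky → All.lookup x∉xs y∈xs (inj (here refl) (there y∈xs) kx≡ky))
  ∷ map-unique k xs u (λ p∈ q∈ → inj (there p∈) (there q∈))

injective-key-length : ∀ {A : Set} n (k : A → ℕ) (xs : List A) →
  Unique xs → InjectiveOn k xs → All (λ p → 1 ≤ k p × k p ≤ n) xs → length xs ≤ n
injective-key-length n k xs u inj range = begin
  length xs         ≡⟨ sym (length-map k xs) ⟩
  length (map k xs) ≤⟨ unique-in-range-length n (map k xs) (map-unique k xs u inj) (All.map⁺ range) ⟩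
  n                 ∎
  where open ≤-Reasoning

Below : Point → Point → Set
Below a p = proj₁ a ≡ proj₁ p × proj₂ a < proj₂ p

same-coordinates : ∀ {p q : Point} → proj₁ p ≡ proj₁ q → proj₂ p ≡ proj₂ q → p ≡ q
same-coordinates ex ey = ×-≡,≡→≡ (ex , ey)

incomparable-equal : ∀ {m n : ℕ} → ¬ m < n → ¬ n < m → m ≡ n
incomparable-equal m≮n n≮m = ≤-antisym (≮⇒≥ n≮m) (≮⇒≥ m≮n)

LazyLFree : List Point → Set
LazyLFree S = ∀ a b c → a ∈ S → b ∈ S → c ∈ S → ¬ LazyL a b c

module _ (S : List Point) where

  Raised : Point → Set
  Raised p = Any (λ a → Below a p) S

  raised? : ∀ p → Dec (Raised p)
  raised? p = any? (λ a → (proj₁ a ≟ proj₁ p) ×-dec (proj₂ a <? proj₂ p)) S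

  raisedPoints lowestPoints : List Point
  raisedPoints = filter raised? S
  lowestPoints = filter (¬? ∘ raised?) S

  -- In a row, a raised point of S has no raised point to its right:
  -- otherwise (a, p, c) with a below p and c below q is a lazy-L.
  no-raised-to-the-right : LazyLFree S → ∀ {p q} → p ∈ S → Raised p → Raised q →
    proj₂ p ≡ proj₂ q → ¬ proj₁ p < proj₁ q
  no-raised-to-the-right free {p} p∈S raised-p raised-q refl p<q
    with find raised-p | find raised-q
  ... | a , a∈S , (a-col , a<p) | c , c∈S , (refl , c<q) =
    free a p c a∈S p∈S c∈S (a-col , a<p , p<q , c<q)

  raised-member : ∀ {p} → p ∈ raisedPoints → p ∈ S × Raised p
  raised-member = ∈-filter⁻ raised? {xs = S}

  lowest-member : ∀ {p} → p ∈ lowestPoints → p ∈ S × ¬ Raised p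
  lowest-member = ∈-filter⁻ (¬? ∘ raised?) {xs = S}

  raised-rows-injective : LazyLFree S → InjectiveOn proj₂ raisedPoints
  raised-rows-injective free p∈ q∈ same-row
    with (p∈S , raised-p) ← raised-member p∈ | (q∈S , raised-q) ← raised-member q∈ =
    same-coordinates
      (incomparable-equal (no-raised-to-the-right free p∈S raised-p raised-q same-row)
                          (no-raised-to-the-right free q∈S raised-q raised-p (sym same-row)))
      same-row

  -- Distinct lowest points lie in distinct columns: the lower of two points
  -- in one column would make the other raised.
  lowest-columns-injective : InjectiveOn proj₁ lowestPoints
  lowest-columns-injective p∈ q∈ same-column
    with (p∈S , lowest-p) ← lowest-member p∈ | (q∈S , lowest-q) ← lowest-member q∈ =
    same-coordinates same-column
      (incomparable-equal (λ p<q → lowest-q (lose p∈S (same-column , p<q)))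
                          (λ q<p → lowest-p (lose q∈S (sym same-column , q<p))))

lemma11 : (n : ℕ) (S : List Point) → Unique S → All (InGrid n) S →
    (∀ a b c → a ∈ S → b ∈ S → c ∈ S → ¬ LazyL a b c) →
    length S ≤ 3 * n
lemma11 n S unique grid free = begin
  length S
    ≡⟨ length-filter-split (raised? S) S ⟩
  length (raisedPoints S) + length (lowestPoints S)
    ≤⟨ +-mono-≤
         (injective-key-length n proj₂ (raisedPoints S) (filter⁺ _ unique)
            (raised-rows-injective S free) (All.filter⁺ _ (All.map proj₂ grid)))
         (injective-key-length n proj₁ (lowestPoints S) (filter⁺ _ unique)
            (lowest-columns-injective S) (All.filter⁺ _ (All.map proj₁ grid))) ⟩
  n + n
    ≤⟨ +-monoʳ-≤ n (m≤m+n n (n + 0)) ⟩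
  3 * n ∎
  where open ≤-Reasoning
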